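{- Let $P$ be a finite graded poset of rank $n$, and let $q,\ell$ be positive integers with $q\ge n+2$. For $0\le m\le n$ let $P_m$ be the set of elements of $P$ of rank $m$, and for $j\in[q-n-1]$ let $\tau_{(P_m,j)}$ be the composition of the toggles $\tau_{(p,j)}$, $p\in P_m$, on $\mathcal{A}^\ell(P\times[q-n-1])$, and let $\mathrm{Row}^{ -1}(P\times\{j\})=\tau_{(P_n,j)}\circ\tau_{(P_{n-1},j)}\circ\cdots\circ\tau_{(P_0,j)}$. Then, as maps on $\mathcal{A}^\ell(P\times[q-n-1])$, \[\mathrm{TogPro}=\mathrm{Row}^{ -1}(P\times\{1\})\circ\mathrm{Row}^{ -1}(P\times\{2\})\circ\cdots\circ\mathrm{Row}^{ -1}(P\times\{q-n-1\}).\]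
   Context: A finite poset is graded of rank $n$ if every maximal chain has $n+1$ elements; minimal elements have rank $0$. $[m]=\{1<\dots<m\}$ and $P\times[m]$ has the product order. For a finite poset $Q$, $\hat Q$ is $Q$ with a new minimum $\hat0$ and maximum $\hat1$ adjoined; $\mathcal{A}^\ell(Q)$ is the set of order-preserving maps $\sigma:\hat Q\to\mathbb{Z}_{\ge0}$ with $\sigma(\hat0)=0$, $\sigma(\hat1)=\ell$. For $x\in Q$, the toggle $\tau_x$ changes only the value at $x$, replacing $\sigma(x)$ by $\min\{\sigma(y):y\text{ covers }x\text{ in }\hat Q\}+\max\{\sigma(y):y\text{ is covered by }x\text{ in }\hat Q\}-\sigma(x)$. Toggles at elements not related by a cover commute. Toggle-promotion on $\mathcal{A}^\ell(P\times[q-n-1])$ is $\mathrm{TogPro}=\tau_{q-1}\circ\tau_{q-2}\circ\cdots\circ\tau_1$, where $\tau_k$ is the composition of all toggles $\tau_{(p,i)}$ with $p\in P$ and $i=q-n+\operatorname{rank}(p)-k\in[q-n-1]$. -}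

module Defs where

open import Data.Nat using (ℕ; zero; suc; _+_; _∸_; _⊓_; _⊔_)
open import Data.Fin using (Fin; toℕ)
import Data.Fin as Fin
open import Data.Fin.Properties using () renaming (_≟_ to _≟F_)
open import Data.List using (List; []; _∷_; map; filter; foldr; allFin; length; upTo; cartesianProduct; reverse)
open import Data.List.Membership.Propositional using (_∈_)
open import Data.List.Relation.Unary.Linked using (Linked)
open import Data.List.Relation.Unary.All using (All)
open import Data.List.Relation.Unary.Any using (any?)
open import Data.Product using (_×_; _,_; proj₁; proj₂)
open import Data.Product.Properties using (≡-dec)
open import Data.Sum using (_⊎_)
open import Data.Bool using (Bool; true; false; if_then_else_)
open import Relation.Nullary using (¬_; Dec; yes; no; does)
open import Relation.Nullary.Decidable using (_×-dec_; ¬?)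
open import Relation.Binary using (Decidable; IsPartialOrder)
open import Relation.Binary.PropositionalEquality using (_≡_; _≢_)

record FinPoset : Set₁ where
  field
    size           : ℕ
    _≤_            : Fin size → Fin size → Set
    _≤?_           : Decidable _≤_
    isPartialOrder : IsPartialOrder _≡_ _≤_

module _ (P : FinPoset) where
  open FinPoset P

  _<P_ : Fin size → Fin size → Set
  x <P y = x ≤ y × x ≢ y

  _<P?_ : Decidable _<P_
  x <P? y = (x ≤? y) ×-dec ¬? (x ≟F y)

  IsChain : List (Fin size) → Set
  IsChain c = Linked _<P_ c

  IsMaximalChain : List (Fin size) → Set
  IsMaximalChain c = IsChain c ×
    ((y : Fin size) → All (λ x → x ≤ y ⊎ y ≤ x) c → y ∈ c)

  IsGraded : ℕ → Set
  IsGraded n = (c : List (Fin size)) → IsMaximalChain c → length c ≡ n + 1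

  height : ℕ → Fin size → ℕ
  height zero    p = 0
  height (suc f) p =
    foldr _⊔_ 0 (map (λ r → suc (height f r)) (filter (λ r → r <P? p) (allFin size)))

  -- rank of p (minimal elements have rank 0); fuel = size suffices
  rank : Fin size → ℕ
  rank p = height size p

-- The poset Q = P × [m]; element (p , j) with j : Fin m stands for (p , j+1).

module _ (P : FinPoset) (m : ℕ) where
  open FinPoset P

  Elt : Set
  Elt = Fin size × Fin m

  _≤Q_ : Elt → Elt → Set
  (p , i) ≤Q (p' , i') = p ≤ p' × i Fin.≤ i'

  _≤Q?_ : Decidable _≤Q_
  (p , i) ≤Q? (p' , i') = (p ≤? p') ×-dec (i Fin.≤? i')

  _≟Q_ : (x y : Elt) → Dec (x ≡ y)
  _≟Q_ = ≡-dec _≟F_ _≟F_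

  _<Q_ : Elt → Elt → Set
  x <Q y = x ≤Q y × x ≢ y

  _<Q?_ : Decidable _<Q_
  x <Q? y = (x ≤Q? y) ×-dec ¬? (x ≟Q y)

  allQ : List Elt
  allQ = cartesianProduct (allFin size) (allFin m)

  _⋖Q_ : Elt → Elt → Set
  x ⋖Q y = x <Q y × ¬ (Data.List.Relation.Unary.Any.Any (λ z → x <Q z × z <Q y) allQ)

  _⋖Q?_ : Decidable _⋖Q_
  x ⋖Q? y = (x <Q? y) ×-dec ¬? (any? (λ z → (x <Q? z) ×-dec (z <Q? y)) allQ)

  upCovers : Elt → List Elt
  upCovers x = filter (λ y → x ⋖Q? y) allQ

  downCovers : Elt → List Elt
  downCovers x = filter (λ y → y ⋖Q? x) allQ

  -- A^ℓ(Q): order-preserving maps on Q̂ with σ(0̂)=0, σ(1̂)=ℓ;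
  -- recorded by the values on Q.
  InA : ℕ → (Elt → ℕ) → Set
  InA ℓ σ = ((x y : Elt) → x ≤Q y → σ x Data.Nat.≤ σ y) × ((x : Elt) → σ x Data.Nat.≤ ℓ)

  -- min of σ over the elements covering x in Q̂ (1̂ covers x iff x maximal in Q)
  minUp : ℕ → (Elt → ℕ) → Elt → ℕ
  minUp ℓ σ x with upCovers x
  ... | []     = ℓ
  ... | y ∷ ys = foldr (λ z acc → σ z ⊓ acc) (σ y) ys

  -- max of σ over the elements covered by x in Q̂ (0̂ covered by x iff x minimal in Q)
  maxDown : (Elt → ℕ) → Elt → ℕ
  maxDown σ x with downCovers x
  ... | []     = 0
  ... | y ∷ ys = foldr (λ z acc → σ z ⊔ acc) (σ y) ys

  toggle : ℕ → Elt → (Elt → ℕ) → (Elt → ℕ)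
  toggle ℓ x σ z with does (z ≟Q x)
  ... | true  = (minUp ℓ σ x + maxDown σ x) ∸ σ x
  ... | false = σ z

-- apply a list of maps, first element of the list first:
-- seqApply (f₁ ∷ f₂ ∷ … ∷ fₖ ∷ []) = fₖ ∘ … ∘ f₂ ∘ f₁
seqApply : {A : Set} → List (A → A) → A → A
seqApply []       a = a
seqApply (f ∷ fs) a = seqApply fs (f a)

-- [a, a+1, …, b] as naturals (empty if b < a)
range : ℕ → ℕ → List ℕ
range a b = map (λ i → a + i) (upTo (suc b ∸ a))

chainLen : ℕ → ℕ → ℕ
chainLen n q = q ∸ n ∸ 1

module _ (P : FinPoset) (n q ℓ : ℕ) where
  open FinPoset P

  private
    m : ℕ
    m = chainLen n q

  -- τ_k : all toggles at (p , i) with i = q - n + rank(p) - k ∈ [m]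
  --   (for j : Fin m, i = toℕ j + 1)
  togStep : ℕ → (Elt P m → ℕ) → (Elt P m → ℕ)
  togStep k = seqApply (map (toggle P m ℓ)
    (filter (λ x → (suc (toℕ (proj₂ x)) + k) Data.Nat.≟ ((q ∸ n) + rank P (proj₁ x))) (allQ P m)))

  TogPro : (Elt P m → ℕ) → (Elt P m → ℕ)
  TogPro = seqApply (map togStep (range 1 (q ∸ 1)))

  rankToggle : ℕ → Fin m → (Elt P m → ℕ) → (Elt P m → ℕ)
  rankToggle r j = seqApply (map (λ p → toggle P m ℓ (p , j))
    (filter (λ p → rank P p Data.Nat.≟ r) (allFin size)))

  RowInv : Fin m → (Elt P m → ℕ) → (Elt P m → ℕ)
  RowInv j = seqApply (map (λ r → rankToggle r j) (range 0 n))

  RowComposite : (Elt P m → ℕ) → (Elt P m → ℕ)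
  RowComposite = seqApply (map RowInv (reverse (allFin m)))

{-# OPTIONS --safe #-}
-- TogPro toggles every element of P × [q−n−1] exactly once, diagonal by
-- diagonal in increasing order of rank(p) − j; the row composite also toggles
-- every element once, row by row from j = q−n−1 down to 1, each row by
-- increasing rank. Toggles at distinct elements neither of which covers the
-- other commute, so it suffices that the two orders agree on every covering
-- pair. A cover either raises j at fixed p, and then both sweeps toggle the
-- upper element first (it lies on a lower diagonal and a higher row), or raises
-- the rank at fixed j, and then both toggle the lower element first (it lies on
-- a lower diagonal in the same row).
module Submission where

open import Defs
open import Level using (0ℓ)
open import Function using (_∘_; flip)
open import Data.Nat using (ℕ; zero; suc; _+_; _∸_; _⊔_; _⊓_; _≤_; _<_; z≤n; s≤s; s≤s⁻¹)
import Data.Nat as ℕ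
open import Data.Nat.Properties
  using ( ≤-refl; ≤-trans; ≤-reflexive; ≤-antisym; <⇒≤; <⇒≢; <⇒≱; <-irrefl; <-asym; ≤∧≢⇒<
        ; ≤-<-connex; n≤1+n; m≤n+m; m≤m⊔n; m≤n⊔m; ⊔-lub; ⊔-sel; +-comm; +-assoc; +-suc
        ; +-monoˡ-≤; +-monoʳ-≤; +-mono-≤; +-monoʳ-<; +-cancelˡ-≤; +-cancelʳ-≤; +-cancelˡ-≡
        ; m+[n∸m]≡n; m+n∸m≡n; m∸n≤m; m≤n⇒∃[o]m+o≡n; module ≤-Reasoning )
open import Data.Nat.Tactic.RingSolver using (solve-∀)
open import Data.Fin using (Fin; toℕ)
import Data.Fin as Fin
import Data.Fin.Properties as Fin
open import Data.List using (List; []; _∷_; [_]; _++_; map; filter; foldr; concatMap; allFin; length; lookup; reverse)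
open import Data.List.Properties using (map-++; map-∘; unfold-reverse; length-++)
open import Data.List.Membership.Propositional using (_∈_; _∉_; lose)
open import Data.List.Membership.Propositional.Properties
  using (∈-map⁺; ∈-map⁻; ∈-filter⁺; ∈-filter⁻; ∈-allFin; ∈-upTo⁺; ∈-cartesianProduct⁺; ∈-lookup
        ; ∈-++⁺ˡ; ∈-++⁺ʳ; ∈-++⁻; ∈-∃++; ∈-concat⁺′; ∈-concat⁻′)
import Data.List.Membership.DecPropositional as DecMembership
open import Data.List.Relation.Binary.Subset.Propositional using (_⊆_)
open import Data.List.Relation.Binary.Permutation.Propositional using (_↭_; ↭-refl; ↭-prep; ↭-swap; ↭-trans)
open import Data.List.Relation.Binary.Permutation.Propositional.Properties using (∈-resp-↭; ↭-length)
open import Data.List.Relation.Unary.Any using (here; there; any?; satisfied)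
import Data.List.Relation.Unary.Any.Properties as Any
open import Data.List.Relation.Unary.All using (All; []; _∷_; all?)
import Data.List.Relation.Unary.All as All
import Data.List.Relation.Unary.All.Properties as All
open import Data.List.Relation.Unary.AllPairs using (AllPairs; []; _∷_)
import Data.List.Relation.Unary.AllPairs as AllPairs
import Data.List.Relation.Unary.AllPairs.Properties as AllPairs
open import Data.List.Relation.Unary.Linked.Properties using (AllPairs⇒Linked)
open import Data.List.Relation.Unary.Unique.Propositional using (Unique)
import Data.List.Relation.Unary.Unique.Propositional.Properties as Unique
open import Data.Product using (∃; _×_; _,_; proj₁; proj₂)
open import Data.Sum using (_⊎_; inj₁; inj₂)
import Data.Sum as Sum
open import Data.Empty using (⊥-elim)
open import Relation.Nullary using (¬_; Dec; yes; no)
open import Relation.Nullary.Decidable using (_×-dec_; _⊎-dec_; ¬?)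
open import Relation.Binary using (Setoid; IsPartialOrder)
open import Relation.Binary.PropositionalEquality as ≡
  using (_≡_; _≢_; _≗_; refl; cong; cong₂; cong-app; subst; subst₂; ≢-sym; _→-setoid_; module ≡-Reasoning)

module _ {A : Set} where

  seqApply-++ : (fs gs : List (A → A)) (a : A) → seqApply (fs ++ gs) a ≡ seqApply gs (seqApply fs a)
  seqApply-++ []       gs a = refl
  seqApply-++ (f ∷ fs) gs a = seqApply-++ fs gs (f a)

  seqApply-concatMap : {B C : Set} (act : B → A → A) (g : C → List B) (f : C → A → A) →
                       (∀ c a → f c a ≡ seqApply (map act (g c)) a) →
                       ∀ cs a → seqApply (map f cs) a ≡ seqApply (map act (concatMap g cs)) a
  seqApply-concatMap act g f f≡ []       a = refl
  seqApply-concatMap act g f f≡ (c ∷ cs) a = begin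
    seqApply (map f cs) (f c a)
      ≡⟨ cong (seqApply (map f cs)) (f≡ c a) ⟩
    seqApply (map f cs) (seqApply (map act (g c)) a)
      ≡⟨ seqApply-concatMap act g f f≡ cs _ ⟩
    seqApply (map act (concatMap g cs)) (seqApply (map act (g c)) a)
      ≡⟨ seqApply-++ (map act (g c)) _ a ⟨
    seqApply (map act (g c) ++ map act (concatMap g cs)) a
      ≡⟨ cong (λ fs → seqApply fs a) (map-++ act (g c) (concatMap g cs)) ⟨
    seqApply (map act (concatMap g (c ∷ cs))) a ∎
    where open ≡-Reasoning

  foldr-cong-∈ : {B C : Set} (_∙_ : B → C → C) {g h : A → B} (xs : List A) (e : C) →
                 (∀ {x} → x ∈ xs → g x ≡ h x) →
                 foldr (λ x acc → g x ∙ acc) e xs ≡ foldr (λ x acc → h x ∙ acc) e xs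
  foldr-cong-∈ _∙_ []       e g≡h = refl
  foldr-cong-∈ _∙_ (x ∷ xs) e g≡h = cong₂ _∙_ (g≡h (here refl)) (foldr-cong-∈ _∙_ xs e (g≡h ∘ there))

  ∈-concatMap⁺ : {B : Set} {g : B → List A} {x : A} {b : B} {bs : List B} →
                 x ∈ g b → b ∈ bs → x ∈ concatMap g bs
  ∈-concatMap⁺ {g = g} x∈gb b∈bs = ∈-concat⁺′ x∈gb (∈-map⁺ g b∈bs)

  ∈-concatMap⁻ : {B : Set} (g : B → List A) {x : A} (bs : List B) →
                 x ∈ concatMap g bs → ∃ λ b → b ∈ bs × x ∈ g b
  ∈-concatMap⁻ g bs x∈ with xs , x∈xs , xs∈ ← ∈-concat⁻′ (map g bs) x∈ with b , b∈bs , refl ← ∈-map⁻ g xs∈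
    = b , b∈bs , x∈xs

module _ {A : Set} {R : A → A → Set} where

  AllPairs-lookup : ∀ {xs} → AllPairs R xs → {i j : Fin (length xs)} → i Fin.< j → R (lookup xs i) (lookup xs j)
  AllPairs-lookup {x ∷ xs} (x≺xs ∷ _)       {Fin.zero}  {Fin.suc j} _         = All.lookup x≺xs (∈-lookup j)
  AllPairs-lookup {x ∷ xs} (_ ∷ xs-sorted) {Fin.suc i} {Fin.suc j} (s≤s i<j) = AllPairs-lookup xs-sorted i<j

  AllPairs-reverse⁺ : ∀ {xs} → AllPairs R xs → AllPairs (flip R) (reverse xs)
  AllPairs-reverse⁺ {[]}     []                = []
  AllPairs-reverse⁺ {x ∷ xs} (x≺xs ∷ xs-sorted) rewrite unfold-reverse x xs =
    AllPairs.++⁺ (AllPairs-reverse⁺ xs-sorted) ([] ∷ [])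
      (All.tabulate λ y∈ → All.lookup x≺xs (Any.reverse⁻ y∈) ∷ [])

  AllPairs-dropMid : ∀ bs {a cs} → AllPairs R (bs ++ a ∷ cs) →
                     All (λ b → R b a) bs × All (R a) cs × AllPairs R (bs ++ cs)
  AllPairs-dropMid []       (a≺cs ∷ cs-sorted) = [] , a≺cs , cs-sorted
  AllPairs-dropMid (b ∷ bs) (b≺rest ∷ rest-sorted)
    with bs≺a , a≺cs , bscs-sorted ← AllPairs-dropMid bs rest-sorted
    with b≺a ∷ b≺cs ← All.++⁻ʳ bs b≺rest
    = b≺a ∷ bs≺a , a≺cs , All.++⁺ (All.++⁻ˡ bs b≺rest) b≺cs ∷ bscs-sorted

  AllPairs-map-All : {S : A → A → Set} {Q : A → Set} → (∀ {x y} → Q x → Q y → S x y → R x y) →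
                     ∀ {xs} → All Q xs → AllPairs S xs → AllPairs R xs
  AllPairs-map-All S⇒R []         []                 = []
  AllPairs-map-All S⇒R (qx ∷ qxs) (x≺xs ∷ xs-sorted) =
    All.zipWith (λ (qy , Sxy) → S⇒R qx qy Sxy) (qxs , x≺xs) ∷ AllPairs-map-All S⇒R qxs xs-sorted

  AllPairs-concatMap⁺ : {B : Set} {S : B → B → Set} {g : B → List A} →
                        (∀ b → AllPairs R (g b)) →
                        (∀ {b b' x y} → S b b' → x ∈ g b → y ∈ g b' → R x y) →
                        ∀ {bs} → AllPairs S bs → AllPairs R (concatMap g bs)
  AllPairs-concatMap⁺ within across bs-sorted =
    AllPairs.concat⁺ (All.map⁺ (All.tabulate λ {b} _ → within b))
      (AllPairs.map⁺ (AllPairs.map (λ Sbb' → All.tabulate λ x∈ → All.tabulate λ y∈ → across Sbb' x∈ y∈) bs-sorted))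

Unique⇒length≤ : ∀ {n} {xs : List (Fin n)} → Unique xs → length xs ≤ n
Unique⇒length≤ {n} {xs} xs-unique with ≤-<-connex (length xs) n
... | inj₁ length≤n = length≤n
... | inj₂ n<length with i , j , i<j , same ← Fin.pigeonhole n<length (lookup xs) =
  ⊥-elim (AllPairs-lookup xs-unique i<j same)

range-sorted : ∀ a b → AllPairs _<_ (range a b)
range-sorted a b = AllPairs.map⁺ (AllPairs.applyUpTo⁺₁ (λ i → i) (suc b ∸ a) (λ i<j _ → +-monoʳ-< a i<j))

module _ {A : Set} where

  maxOver : (A → ℕ) → List A → ℕ
  maxOver g xs = foldr _⊔_ 0 (map g xs)

  ≤-maxOver : (g : A → ℕ) {x : A} {xs : List A} → x ∈ xs → g x ≤ maxOver g xs
  ≤-maxOver g {xs = y ∷ ys} (here refl) = m≤m⊔n (g y) (maxOver g ys)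
  ≤-maxOver g {xs = y ∷ ys} (there x∈) = ≤-trans (≤-maxOver g x∈) (m≤n⊔m (g y) (maxOver g ys))

  maxOver-≤ : (g : A → ℕ) {b : ℕ} (xs : List A) → (∀ {x} → x ∈ xs → g x ≤ b) → maxOver g xs ≤ b
  maxOver-≤ g []       bound = z≤n
  maxOver-≤ g (y ∷ ys) bound = ⊔-lub (bound (here refl)) (maxOver-≤ g ys (bound ∘ there))

  maxOver-attained : (g : A → ℕ) (xs : List A) → maxOver g xs ≡ 0 ⊎ ∃ λ x → x ∈ xs × maxOver g xs ≡ g x
  maxOver-attained g []       = inj₁ refl
  maxOver-attained g (y ∷ ys) with ⊔-sel (g y) (maxOver g ys)
  ... | inj₁ max≡gy = inj₂ (y , here refl , max≡gy)
  ... | inj₂ max≡rest with maxOver-attained g ys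
  ...   | inj₁ rest≡0              = inj₁ (≡.trans max≡rest rest≡0)
  ...   | inj₂ (x , x∈ys , rest≡gx) = inj₂ (x , there x∈ys , ≡.trans max≡rest rest≡gx)

  maxOver-≡⊎≡bound : (g₁ g₂ : A → ℕ) (b : ℕ) (xs : List A) →
                     (∀ {x} → x ∈ xs → g₂ x ≡ g₁ x ⊎ g₂ x ≡ b) → (∀ {x} → x ∈ xs → g₂ x ≤ b) →
                     maxOver g₂ xs ≡ maxOver g₁ xs ⊎ maxOver g₂ xs ≡ b
  maxOver-≡⊎≡bound g₁ g₂ b []       _     _     = inj₁ refl
  maxOver-≡⊎≡bound g₁ g₂ b (y ∷ ys) cases bound
    with cases (here refl) | maxOver-≡⊎≡bound g₁ g₂ b ys (cases ∘ there) (bound ∘ there)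
  ... | inj₁ same | inj₁ rest-same = inj₁ (cong₂ _⊔_ same rest-same)
  ... | inj₂ at-b | _              = inj₂ (≤-antisym (maxOver-≤ g₂ (y ∷ ys) bound)
    (subst (_≤ maxOver g₂ (y ∷ ys)) at-b (≤-maxOver g₂ {xs = y ∷ ys} (here refl))))
  ... | inj₁ _    | inj₂ rest-at-b = inj₂ (≤-antisym (maxOver-≤ g₂ (y ∷ ys) bound)
    (subst (_≤ maxOver g₂ (y ∷ ys)) rest-at-b (m≤n⊔m (g₂ y) (maxOver g₂ ys))))

-- Reordering a sequence of commuting actions

module Reordering {ℓ} (S : Setoid 0ℓ ℓ) {A : Set}
                  (act : A → Setoid.Carrier S → Setoid.Carrier S)
                  (act-cong : ∀ a {s t} → Setoid._≈_ S s t → Setoid._≈_ S (act a s) (act a t)) where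
  open Setoid S using (Carrier; _≈_) renaming (refl to ≈-refl; sym to ≈-sym; trans to ≈-trans)

  run : List A → Carrier → Carrier
  run xs = seqApply (map act xs)

  Commute : A → A → Set ℓ
  Commute a b = ∀ s → act a (act b s) ≈ act b (act a s)

  run-cong : ∀ xs {s t} → s ≈ t → run xs s ≈ run xs t
  run-cong []       s≈t = s≈t
  run-cong (a ∷ xs) s≈t = run-cong xs (act-cong a s≈t)

  run-moveToFront : ∀ {a} bs cs s → All (Commute a) bs → run (bs ++ a ∷ cs) s ≈ run (bs ++ cs) (act a s)
  run-moveToFront []       cs s []         = ≈-refl
  run-moveToFront (b ∷ bs) cs s (ab ∷ abs) = ≈-trans (run-moveToFront bs cs (act b s) abs) (run-cong (bs ++ cs) (ab s))

  module _ {R₁ R₂ : A → A → Set}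
           (R₁⇒≢ : ∀ {x y} → R₁ x y → x ≢ y) (R₂⇒≢ : ∀ {x y} → R₂ x y → x ≢ y)
           (opposite⇒commute : ∀ {x y} → R₁ x y → R₂ y x → Commute x y) where

    run-reorder : ∀ {xs ys} → AllPairs R₁ xs → AllPairs R₂ ys → xs ⊆ ys → ys ⊆ xs → ∀ s → run xs s ≈ run ys s
    run-reorder {[]}     {[]}     _ _ _ _ s = ≈-refl
    run-reorder {[]}     {y ∷ ys} _ _ _ ys⊆[] s with () ← ys⊆[] (here refl)
    run-reorder {a ∷ xs} {ys} (a≺xs ∷ xs-sorted) ys-sorted xs⊆ys ys⊆xs s
      with bs , cs , refl ← ∈-∃++ (xs⊆ys (here refl))
      with bs≺a , a≺cs , bscs-sorted ← AllPairs-dropMid bs ys-sorted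
      = ≈-trans (run-reorder xs-sorted bscs-sorted xs⊆bscs bscs⊆xs (act a s))
              (≈-sym (run-moveToFront bs cs s a-commutes))
      where
      drop-a : ∀ {x} → x ≢ a → x ∈ a ∷ xs → x ∈ xs
      drop-a x≢a (here x≡a)   = ⊥-elim (x≢a x≡a)
      drop-a _   (there x∈xs) = x∈xs

      a-commutes : All (Commute a) bs
      a-commutes = All.tabulate λ b∈bs →
        let b≺a = All.lookup bs≺a b∈bs in
        opposite⇒commute (All.lookup a≺xs (drop-a (R₂⇒≢ b≺a) (ys⊆xs (∈-++⁺ˡ b∈bs)))) b≺a

      xs⊆bscs : xs ⊆ bs ++ cs
      xs⊆bscs x∈xs with ∈-++⁻ bs (xs⊆ys (there x∈xs))
      ... | inj₁ x∈bs         = ∈-++⁺ˡ x∈bs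
      ... | inj₂ (here x≡a)   = ⊥-elim (R₁⇒≢ (All.lookup a≺xs x∈xs) (≡.sym x≡a))
      ... | inj₂ (there x∈cs) = ∈-++⁺ʳ bs x∈cs

      bscs⊆xs : bs ++ cs ⊆ xs
      bscs⊆xs x∈ with ∈-++⁻ bs x∈
      ... | inj₁ x∈bs = drop-a (R₂⇒≢ (All.lookup bs≺a x∈bs)) (ys⊆xs (∈-++⁺ˡ x∈bs))
      ... | inj₂ x∈cs = drop-a (≢-sym (R₂⇒≢ (All.lookup a≺cs x∈cs))) (ys⊆xs (∈-++⁺ʳ bs (there x∈cs)))

-- Heights and ranks

module Ranks (P : FinPoset) where
  open FinPoset P using (size; _≤?_; isPartialOrder) renaming (_≤_ to _⊑_)
  open IsPartialOrder isPartialOrder using (antisym) renaming (refl to ⊑-refl; trans to ⊑-trans)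

  _⊏_ : Fin size → Fin size → Set
  _⊏_ = _<P_ P

  ⊑-⊏-trans : ∀ {x y z} → x ⊑ y → y ⊏ z → x ⊏ z
  ⊑-⊏-trans x⊑y (y⊑z , y≢z) = ⊑-trans x⊑y y⊑z , λ { refl → y≢z (antisym y⊑z x⊑y) }

  length≤size : ∀ {c} → AllPairs _⊏_ c → length c ≤ size
  length≤size = Unique⇒length≤ ∘ AllPairs.map proj₂

  below : Fin size → List (Fin size)
  below p = filter (λ r → _<P?_ P r p) (allFin size)

  height≤fuel : ∀ f p → height P f p ≤ f
  height≤fuel zero    p = z≤n
  height≤fuel (suc f) p = maxOver-≤ (λ r → suc (height P f r)) (below p) λ {r} _ → s≤s (height≤fuel f r)

  height-suc : ∀ f p → height P (suc f) p ≡ height P f p ⊎ height P (suc f) p ≡ suc f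
  height-suc zero p with maxOver-attained (λ r → suc (height P zero r)) (below p)
  ... | inj₁ ≡0            = inj₁ ≡0
  ... | inj₂ (_ , _ , ≡1) = inj₂ ≡1
  height-suc (suc f) p =
    maxOver-≡⊎≡bound (λ r → suc (height P f r)) (λ r → suc (height P (suc f) r)) (suc (suc f)) (below p)
      (λ {r} _ → Sum.map (cong suc) (cong suc) (height-suc f r)) (λ {r} _ → s≤s (height≤fuel (suc f) r))

  height-⊏ : ∀ f {r p} → r ⊏ p → suc (height P f r) ≤ height P (suc f) p
  height-⊏ f {r} r⊏p = ≤-maxOver (λ r → suc (height P f r)) (∈-filter⁺ (λ r → _<P?_ P r _) (∈-allFin r) r⊏p)

  chainBelow : ∀ f p → ∃ λ c → AllPairs _⊏_ c × All (_⊑ p) c × length c ≡ suc (height P f p)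
  chainBelow zero    p = [ p ] , ([] ∷ []) , (⊑-refl ∷ []) , refl
  chainBelow (suc f) p with maxOver-attained (λ r → suc (height P f r)) (below p)
  ... | inj₁ ≡0 = [ p ] , ([] ∷ []) , (⊑-refl ∷ []) , cong suc (≡.sym ≡0)
  ... | inj₂ (r , r∈ , ≡height-r) with c , c-chain , c⊑r , length≡ ← chainBelow f r =
    c ++ [ p ] ,
    AllPairs.++⁺ c-chain ([] ∷ []) (All.map (λ z⊑r → ⊑-⊏-trans z⊑r r⊏p ∷ []) c⊑r) ,
    All.++⁺ (All.map (λ z⊑r → ⊑-trans z⊑r (proj₁ r⊏p)) c⊑r) (⊑-refl ∷ []) ,
    ≡.trans (length-++ c) (≡.trans (+-comm (length c) 1) (cong suc (≡.trans length≡ (≡.sym ≡height-r))))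
    where
    r⊏p : r ⊏ p
    r⊏p = proj₂ (∈-filter⁻ (λ r → _<P?_ P r p) {xs = allFin size} r∈)

  -- No chain is longer than size, so fuel beyond size − 1 changes no height.
  height-stable : ∀ {s} → size ≡ suc s → ∀ p → height P (suc s) p ≡ height P s p
  height-stable {s} size≡ p with height-suc s p
  ... | inj₁ stable = stable
  ... | inj₂ ≡1+s with c , c-chain , _ , length≡ ← chainBelow (suc s) p =
    ⊥-elim (<-irrefl refl (begin
      suc size          ≡⟨ cong suc size≡ ⟩
      suc (suc s)       ≡⟨ ≡.trans length≡ (cong suc ≡1+s) ⟨
      length c          ≤⟨ length≤size c-chain ⟩
      size              ∎))
    where open ≤-Reasoning

  rank-⊏ : ∀ {r p} → r ⊏ p → rank P r < rank P p
  rank-⊏ {r} {p} r⊏p = go size refl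
    where
    -- size occurs in the type of r, so it is generalised to N instead of being rewritten.
    go : ∀ N → N ≡ size → height P N r < height P N p
    go zero    0≡size = ⊥-elim (Fin.¬Fin0 (subst Fin (≡.sym 0≡size) r))
    go (suc s) N≡size = subst (λ h → suc h ≤ height P (suc s) p)
                              (≡.sym (height-stable (≡.sym N≡size) r)) (height-⊏ s r⊏p)

  Comparable : Fin size → Fin size → Set
  Comparable y x = x ⊑ y ⊎ y ⊑ x

  insert : ∀ {y} c → AllPairs _⊏_ c → All (Comparable y) c → y ∉ c →
           ∃ λ c' → AllPairs _⊏_ c' × c' ↭ y ∷ c
  insert     []      []                   []              y∉ = _ , ([] ∷ []) , ↭-refl
  insert {y} (x ∷ c) (x⊏c ∷ c-chain) (inj₂ y⊑x ∷ _)     y∉ =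
    y ∷ x ∷ c , ((y⊏x ∷ All.map (⊑-⊏-trans y⊑x) x⊏c) ∷ x⊏c ∷ c-chain) , ↭-refl
    where y⊏x = y⊑x , y∉ ∘ here
  insert {y} (x ∷ c) (x⊏c ∷ c-chain) (inj₁ x⊑y ∷ cmp)   y∉
    with c' , c'-chain , c'↭ ← insert c c-chain cmp (y∉ ∘ there) =
    x ∷ c' , (All.tabulate (λ z∈c' → All.lookup (x⊏y ∷ x⊏c) (∈-resp-↭ c'↭ z∈c')) ∷ c'-chain) ,
    ↭-trans (↭-prep x c'↭) (↭-swap x y ↭-refl)
    where x⊏y = x⊑y , y∉ ∘ here ∘ ≡.sym

  open DecMembership (Fin._≟_ {size}) using (_∈?_)

  extendToMaximal : ∀ f c → AllPairs _⊏_ c → size < length c + f →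
                    ∃ λ d → IsMaximalChain P d × length c ≤ length d
  extendToMaximal f c c-chain bound
    with any? (λ y → all? (λ x → (x ≤? y) ⊎-dec (y ≤? x)) c ×-dec ¬? (y ∈? c)) (allFin size)
  extendToMaximal f c c-chain bound | no none = c , (AllPairs⇒Linked c-chain , maximal) , ≤-refl
    where
    maximal : ∀ y → All (Comparable y) c → y ∈ c
    maximal y cmp with y ∈? c
    ... | yes y∈c = y∈c
    ... | no  y∉c = ⊥-elim (none (lose (∈-allFin y) (cmp , y∉c)))
  extendToMaximal zero c c-chain bound | yes _ =
    ⊥-elim (<⇒≱ bound (≤-trans (≤-reflexive (+-comm (length c) 0)) (length≤size c-chain)))
  extendToMaximal (suc f) c c-chain bound | yes some
    with y , cmp , y∉c ← satisfied some
    with c' , c'-chain , c'↭ ← insert c c-chain cmp y∉c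
    with d , d-maximal , c'≤d ← extendToMaximal f c' c'-chain
           (subst (size <_) (≡.trans (+-suc (length c) f) (cong (_+ f) (≡.sym (↭-length c'↭)))) bound)
    = d , d-maximal , ≤-trans (n≤1+n (length c)) (subst (_≤ length d) (↭-length c'↭) c'≤d)

  rank≤ : ∀ {n} → IsGraded P n → ∀ p → rank P p ≤ n
  rank≤ {n} graded p
    with c , c-chain , _ , length≡ ← chainBelow size p
    with d , d-maximal , c≤d ← extendToMaximal (suc size) c c-chain (m≤n+m (suc size) (length c))
    = s≤s⁻¹ (begin
      suc (rank P p)  ≡⟨ length≡ ⟨
      length c        ≤⟨ c≤d ⟩
      length d        ≡⟨ graded d d-maximal ⟩
      n + 1           ≡⟨ +-comm n 1 ⟩
      suc n           ∎)
    where open ≤-Reasoning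

-- Toggles

module Toggles (P : FinPoset) (m ℓ : ℕ) where
  open FinPoset P using (isPartialOrder)
  open IsPartialOrder isPartialOrder using () renaming (refl to ⊑-refl)
  open Ranks P using (_⊏_)

  private
    τ = toggle P m ℓ
    _⋖_ = _⋖Q_ P m

  ⋖-cases : ∀ {p p' i i'} → (p , i) ⋖ (p' , i') → (p ≡ p' × toℕ i < toℕ i') ⊎ (i ≡ i' × p ⊏ p')
  ⋖-cases {p} {p'} {i} {i'} (((p⊑p' , i≤i') , x≢y) , nothing-between) with p Fin.≟ p' | i Fin.≟ i'
  ... | yes refl | yes refl = ⊥-elim (x≢y refl)
  ... | yes refl | no i≢i'  = inj₁ (refl , ≤∧≢⇒< i≤i' (i≢i' ∘ Fin.toℕ-injective))
  ... | no p≢p'  | yes refl = inj₂ (refl , p⊑p' , p≢p')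
  ... | no p≢p'  | no i≢i'  = ⊥-elim (nothing-between (lose (∈-cartesianProduct⁺ (∈-allFin p') (∈-allFin i))
        (((p⊑p' , ≤-refl) , p≢p' ∘ cong proj₁) , ((⊑-refl , i≤i') , i≢i' ∘ cong proj₂))))

  toggle-≢ : ∀ {x z} σ → z ≢ x → τ x σ z ≡ σ z
  toggle-≢ {x} {z} σ z≢x with _≟Q_ P m z x
  ... | yes z≡x = ⊥-elim (z≢x z≡x)
  ... | no  _   = refl

  toggle-≡ : ∀ x σ → τ x σ x ≡ minUp P m ℓ σ x + maxDown P m σ x ∸ σ x
  toggle-≡ x σ with _≟Q_ P m x x
  ... | yes _   = refl
  ... | no  x≢x = ⊥-elim (x≢x refl)

  minUp-cong : ∀ {σ σ'} x → (∀ {z} → z ∈ upCovers P m x → σ z ≡ σ' z) → minUp P m ℓ σ x ≡ minUp P m ℓ σ' x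
  minUp-cong {σ} {σ'} x agree with upCovers P m x
  ... | []     = refl
  ... | y ∷ ys = ≡.trans (foldr-cong-∈ _⊓_ ys (σ y) (agree ∘ there))
                         (cong (λ v → foldr (λ z acc → σ' z ⊓ acc) v ys) (agree (here refl)))

  maxDown-cong : ∀ {σ σ'} x → (∀ {z} → z ∈ downCovers P m x → σ z ≡ σ' z) → maxDown P m σ x ≡ maxDown P m σ' x
  maxDown-cong {σ} {σ'} x agree with downCovers P m x
  ... | []     = refl
  ... | y ∷ ys = ≡.trans (foldr-cong-∈ _⊔_ ys (σ y) (agree ∘ there))
                         (cong (λ v → foldr (λ z acc → σ' z ⊔ acc) v ys) (agree (here refl)))

  toggle-at-self-cong : ∀ {σ σ'} x → (∀ {z} → x ⋖ z → σ z ≡ σ' z) → (∀ {z} → z ⋖ x → σ z ≡ σ' z) →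
                        σ x ≡ σ' x → τ x σ x ≡ τ x σ' x
  toggle-at-self-cong {σ} {σ'} x agree-up agree-down agree-x = begin
    τ x σ x
      ≡⟨ toggle-≡ x σ ⟩
    minUp P m ℓ σ x + maxDown P m σ x ∸ σ x
      ≡⟨ cong₂ _∸_ (cong₂ _+_ (minUp-cong x up) (maxDown-cong x down)) agree-x ⟩
    minUp P m ℓ σ' x + maxDown P m σ' x ∸ σ' x
      ≡⟨ toggle-≡ x σ' ⟨
    τ x σ' x
      ∎
    where
    open ≡-Reasoning
    up : ∀ {z} → z ∈ upCovers P m x → σ z ≡ σ' z
    up z∈ = agree-up (proj₂ (∈-filter⁻ (λ y → _⋖Q?_ P m x y) {xs = allQ P m} z∈))
    down : ∀ {z} → z ∈ downCovers P m x → σ z ≡ σ' z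
    down z∈ = agree-down (proj₂ (∈-filter⁻ (λ y → _⋖Q?_ P m y x) {xs = allQ P m} z∈))

  toggle-cong : ∀ x {σ σ'} → σ ≗ σ' → τ x σ ≗ τ x σ'
  toggle-cong x {σ} {σ'} σ≗σ' z = at (_≟Q_ P m z x)
    where
    at : Dec (z ≡ x) → τ x σ z ≡ τ x σ' z
    at (yes refl) = toggle-at-self-cong z (λ _ → σ≗σ' _) (λ _ → σ≗σ' _) (σ≗σ' z)
    at (no  z≢x)  = ≡.trans (toggle-≢ σ z≢x) (≡.trans (σ≗σ' z) (≡.sym (toggle-≢ σ' z≢x)))

  toggle-after-nonadjacent-toggle : ∀ {x y} σ → x ≢ y → ¬ x ⋖ y → ¬ y ⋖ x → τ x (τ y σ) x ≡ τ x σ x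
  toggle-after-nonadjacent-toggle {x} σ x≢y x⋖̸y y⋖̸x = toggle-at-self-cong x
    (λ x⋖z → toggle-≢ σ λ { refl → x⋖̸y x⋖z }) (λ z⋖x → toggle-≢ σ λ { refl → y⋖̸x z⋖x }) (toggle-≢ σ x≢y)

  toggles-commute : ∀ {x y} σ → x ≢ y → ¬ x ⋖ y → ¬ y ⋖ x → τ x (τ y σ) ≗ τ y (τ x σ)
  toggles-commute {x} {y} σ x≢y x⋖̸y y⋖̸x z = at (_≟Q_ P m z x) (_≟Q_ P m z y)
    where
    at : Dec (z ≡ x) → Dec (z ≡ y) → τ x (τ y σ) z ≡ τ y (τ x σ) z
    at (yes refl) (yes refl) = ⊥-elim (x≢y refl)
    at (yes refl) (no  z≢y)  =
      ≡.trans (toggle-after-nonadjacent-toggle σ x≢y x⋖̸y y⋖̸x) (≡.sym (toggle-≢ (τ z σ) z≢y))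
    at (no  z≢x)  (yes refl) =
      ≡.trans (toggle-≢ (τ z σ) z≢x) (≡.sym (toggle-after-nonadjacent-toggle σ (≢-sym x≢y) y⋖̸x x⋖̸y))
    at (no  z≢x)  (no  z≢y)  =
      ≡.trans (toggle-≢ (τ y σ) z≢x)
        (≡.trans (toggle-≢ σ z≢y) (≡.sym (≡.trans (toggle-≢ (τ x σ) z≢y) (toggle-≢ σ z≢x))))

-- Arithmetic of the diagonals

shifted-keys-≤ : ∀ {c a b i j k k'} → k ≤ k' → suc i + k ≡ c + a → suc j + k' ≡ c + b → a + j ≤ b + i
shifted-keys-≤ {c} {a} {b} {i} {j} {k} {k'} k≤k' key-x key-y =
  +-cancelʳ-≤ (c + suc k') (a + j) (b + i) (begin
    (a + j) + (c + suc k')   ≡⟨ rearrange₁ c a j k' ⟩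
    (c + a) + (suc j + k')   ≡⟨ cong₂ _+_ (≡.sym key-x) key-y ⟩
    (suc i + k) + (c + b)    ≤⟨ +-monoˡ-≤ (c + b) (+-monoʳ-≤ (suc i) k≤k') ⟩
    (suc i + k') + (c + b)   ≡⟨ rearrange₂ c b i k' ⟩
    (b + i) + (c + suc k')   ∎)
  where
  open ≤-Reasoning
  rearrange₁ : ∀ c a j k' → (a + j) + (c + suc k') ≡ (c + a) + (suc j + k')
  rearrange₁ = solve-∀
  rearrange₂ : ∀ c b i k' → (suc i + k') + (c + b) ≡ (b + i) + (c + suc k')
  rearrange₂ = solve-∀

key-exists : ∀ {n q r j} → n + 2 ≤ q → r ≤ n → j < chainLen n q →
             ∃ λ i → i < q ∸ 1 × suc j + suc i ≡ q ∸ n + r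
key-exists {n} {_} {r} {j} n+2≤q r≤n j<m with e , refl ← m≤n⇒∃[o]m+o≡n n+2≤q = e ∸ j + r , i<q∸1 , key
  where
  q∸n≡ : n + 2 + e ∸ n ≡ suc (suc e)
  q∸n≡ = ≡.trans (cong (_∸ n) (+-assoc n 2 e)) (m+n∸m≡n n (2 + e))

  q≡ : ∀ n e → n + 2 + e ≡ suc (suc (n + e))
  q≡ = solve-∀

  j≤e : j ≤ e
  j≤e = s≤s⁻¹ (subst (λ d → j < d ∸ 1) q∸n≡ j<m)

  i<q∸1 : e ∸ j + r < n + 2 + e ∸ 1
  i<q∸1 = begin-strict
    e ∸ j + r       ≤⟨ +-mono-≤ (m∸n≤m e j) r≤n ⟩
    e + n           ≡⟨ +-comm e n ⟩
    n + e           <⟨ ≤-refl ⟩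
    suc (n + e)     ≡⟨ cong (_∸ 1) (q≡ n e) ⟨
    n + 2 + e ∸ 1   ∎
    where open ≤-Reasoning

  key : suc j + suc (e ∸ j + r) ≡ n + 2 + e ∸ n + r
  key = begin
    suc j + suc (e ∸ j + r)       ≡⟨ cong suc (+-suc j (e ∸ j + r)) ⟩
    suc (suc (j + (e ∸ j + r)))   ≡⟨ cong (suc ∘ suc) (+-assoc j (e ∸ j) r) ⟨
    suc (suc (j + (e ∸ j) + r))   ≡⟨ cong (λ t → suc (suc (t + r))) (m+[n∸m]≡n j≤e) ⟩
    suc (suc e) + r               ≡⟨ cong (_+ r) q∸n≡ ⟨
    n + 2 + e ∸ n + r             ∎
    where open ≡-Reasoning

-- The diagonal sweep and the row sweep

module Sweeps (P : FinPoset) (n q ℓ : ℕ) (graded : IsGraded P n) (n+2≤q : n + 2 ≤ q) where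
  open FinPoset P using (size)
  open Ranks P using (rank-⊏; rank≤)

  private
    m = chainLen n q
    E = Elt P m
    τ = toggle P m ℓ

    ρ : E → ℕ
    ρ x = rank P (proj₁ x)

    ι : E → ℕ
    ι x = toℕ (proj₂ x)

  open Toggles P m ℓ using (⋖-cases; toggle-cong; toggles-commute)
  open Reordering (E →-setoid ℕ) τ toggle-cong using (Commute; run-reorder)
  open Reordering (E →-setoid ℕ) τ toggle-cong public using (run)

  -- x lies on the diagonal τ_k of TogPro; ι is 0-based, whence the suc.
  OnDiagonal : ℕ → E → Set
  OnDiagonal k x = suc (ι x) + k ≡ q ∸ n + ρ x

  onDiagonal? : ∀ k x → Dec (OnDiagonal k x)
  onDiagonal? k x = suc (ι x) + k ℕ.≟ q ∸ n + ρ x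

  atRank? : ∀ r p → Dec (rank P p ≡ r)
  atRank? r p = rank P p ℕ.≟ r

  diagonal : ℕ → List E
  diagonal k = filter (onDiagonal? k) (allQ P m)

  diagonalSweep : List E
  diagonalSweep = concatMap diagonal (range 1 (q ∸ 1))

  level : Fin m → ℕ → List E
  level j r = map (_, j) (filter (atRank? r) (allFin size))

  row : Fin m → List E
  row j = concatMap (level j) (range 0 n)

  rowSweep : List E
  rowSweep = concatMap row (reverse (allFin m))

  TogPro-run : ∀ σ → TogPro P n q ℓ σ ≡ run diagonalSweep σ
  TogPro-run = seqApply-concatMap τ diagonal (togStep P n q ℓ) (λ _ _ → refl) (range 1 (q ∸ 1))

  RowComposite-run : ∀ σ → RowComposite P n q ℓ σ ≡ run rowSweep σ
  RowComposite-run = seqApply-concatMap τ row (RowInv P n q ℓ)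
    (λ j → seqApply-concatMap τ (level j) (λ r → rankToggle P n q ℓ r j)
             (λ r σ → cong (λ fs → seqApply fs σ) (map-∘ {g = τ} {f = _, j} (filter (atRank? r) (allFin size))))
             (range 0 n))
    (reverse (allFin m))

  _≺diag_ : E → E → Set
  x ≺diag y = ρ x + ι y ≤ ρ y + ι x × x ≢ y

  _≺row_ : E → E → Set
  x ≺row y = (ι y < ι x ⊎ proj₂ x ≡ proj₂ y × ρ x ≤ ρ y) × x ≢ y

  ∈-diagonal⁻ : ∀ {k x} → x ∈ diagonal k → OnDiagonal k x
  ∈-diagonal⁻ {k} x∈ = proj₂ (∈-filter⁻ (onDiagonal? k) {xs = allQ P m} x∈)

  OnDiagonal-injective : ∀ {k k' x} → OnDiagonal k x → OnDiagonal k' x → k ≡ k'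
  OnDiagonal-injective {k} {k'} {x} on-k on-k' = +-cancelˡ-≡ (suc (ι x)) k k' (≡.trans on-k (≡.sym on-k'))

  OnDiagonal-≤ : ∀ {k k' x y} → k ≤ k' → OnDiagonal k x → OnDiagonal k' y → ρ x + ι y ≤ ρ y + ι x
  OnDiagonal-≤ {x = x} {y} = shifted-keys-≤ {q ∸ n} {ρ x} {ρ y} {ι x} {ι y}

  diagonal-sorted : ∀ k → AllPairs _≺diag_ (diagonal k)
  diagonal-sorted k = AllPairs-map-All (λ on-x on-y x≢y → OnDiagonal-≤ ≤-refl on-x on-y , x≢y)
    (All.tabulate (∈-diagonal⁻ {k}))
    (Unique.filter⁺ (onDiagonal? k) (Unique.cartesianProduct⁺ (Unique.allFin⁺ size) (Unique.allFin⁺ m)))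

  diagonalSweep-sorted : AllPairs _≺diag_ diagonalSweep
  diagonalSweep-sorted = AllPairs-concatMap⁺ diagonal-sorted
    (λ k<k' x∈ y∈ → OnDiagonal-≤ (<⇒≤ k<k') (∈-diagonal⁻ x∈) (∈-diagonal⁻ y∈) ,
                    λ { refl → <⇒≢ k<k' (OnDiagonal-injective (∈-diagonal⁻ x∈) (∈-diagonal⁻ y∈)) })
    (range-sorted 1 (q ∸ 1))

  ∈-level⁻ : ∀ {j r x} → x ∈ level j r → proj₂ x ≡ j × ρ x ≡ r
  ∈-level⁻ {j} {r} x∈ with p , p∈ , refl ← ∈-map⁻ (_, j) x∈ =
    refl , proj₂ (∈-filter⁻ (atRank? r) {xs = allFin size} p∈)

  ∈-row⁻ : ∀ {j x} → x ∈ row j → proj₂ x ≡ j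
  ∈-row⁻ {j} x∈ with _ , _ , x∈level ← ∈-concatMap⁻ (level j) (range 0 n) x∈ = proj₁ (∈-level⁻ x∈level)

  level-sorted : ∀ j r → AllPairs _≺row_ (level j r)
  level-sorted j r = AllPairs-map-All
    (λ (jx , rx) (jy , ry) x≢y → inj₂ (≡.trans jx (≡.sym jy) , ≤-reflexive (≡.trans rx (≡.sym ry))) , x≢y)
    (All.tabulate ∈-level⁻)
    (Unique.map⁺ (cong proj₁) (Unique.filter⁺ (atRank? r) (Unique.allFin⁺ size)))

  row-sorted : ∀ j → AllPairs _≺row_ (row j)
  row-sorted j = AllPairs-concatMap⁺ (level-sorted j)
    (λ r<r' x∈ y∈ → let (jx , rx) = ∈-level⁻ x∈ ; (jy , ry) = ∈-level⁻ y∈ in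
       inj₂ (≡.trans jx (≡.sym jy) , subst₂ _≤_ (≡.sym rx) (≡.sym ry) (<⇒≤ r<r')) ,
       λ { refl → <⇒≢ r<r' (≡.trans (≡.sym rx) ry) })
    (range-sorted 0 n)

  rowSweep-sorted : AllPairs _≺row_ rowSweep
  rowSweep-sorted = AllPairs-concatMap⁺ row-sorted
    (λ j'<j x∈ y∈ →
       inj₁ (subst₂ _<_ (cong toℕ (≡.sym (∈-row⁻ y∈))) (cong toℕ (≡.sym (∈-row⁻ x∈))) j'<j) ,
       λ { refl → <⇒≢ j'<j (cong toℕ (≡.trans (≡.sym (∈-row⁻ y∈)) (∈-row⁻ x∈))) })
    (AllPairs-reverse⁺ (AllPairs.tabulate⁺-< (λ i<j → i<j)))

  ∈-diagonalSweep : ∀ x → x ∈ diagonalSweep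
  ∈-diagonalSweep (p , j) with i , i<q∸1 , on-diagonal ← key-exists n+2≤q (rank≤ graded p) (Fin.toℕ<n j) =
    ∈-concatMap⁺ (∈-filter⁺ (onDiagonal? (suc i)) (∈-cartesianProduct⁺ (∈-allFin p) (∈-allFin j)) on-diagonal)
                 (∈-map⁺ (1 +_) (∈-upTo⁺ i<q∸1))

  ∈-rowSweep : ∀ x → x ∈ rowSweep
  ∈-rowSweep (p , j) =
    ∈-concatMap⁺ (∈-concatMap⁺ (∈-map⁺ (_, j) (∈-filter⁺ (atRank? (rank P p)) (∈-allFin p) refl))
                               (∈-map⁺ (0 +_) (∈-upTo⁺ (s≤s (rank≤ graded p)))))
                 (Any.reverse⁺ (∈-allFin j))

  opposite⇒no-cover : ∀ {x y} → x ≺diag y → y ≺row x → ¬ _⋖Q_ P m x y × ¬ _⋖Q_ P m y x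
  opposite⇒no-cover {p , i} {p' , j} (diag , _) (row-order , _) = no-up row-order , no-down row-order
    where
    RowOrder = toℕ i < toℕ j ⊎ j ≡ i × rank P p' ≤ rank P p

    no-up : RowOrder → ¬ _⋖Q_ P m (p , i) (p' , j)
    no-up order cover with ⋖-cases cover | order
    ... | inj₁ (refl , i<j)  | _               = <⇒≱ i<j (+-cancelˡ-≤ (rank P p) _ _ diag)
    ... | inj₂ (refl , _)    | inj₁ i<i        = <-irrefl refl i<i
    ... | inj₂ (refl , p⊏p') | inj₂ (_ , p'≤p) = <⇒≱ (rank-⊏ p⊏p') p'≤p

    no-down : RowOrder → ¬ _⋖Q_ P m (p' , j) (p , i)
    no-down order cover with ⋖-cases cover | order
    ... | inj₁ (refl , j<i)  | inj₁ i<j        = <-asym i<j j<i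
    ... | inj₁ (refl , j<i)  | inj₂ (refl , _) = <-irrefl refl j<i
    ... | inj₂ (refl , p'⊏p) | _               = <⇒≱ (rank-⊏ p'⊏p) (+-cancelʳ-≤ (toℕ i) _ _ diag)

  opposite⇒commute : ∀ {x y} → x ≺diag y → y ≺row x → Commute x y
  opposite⇒commute x≺y y≺x σ with x⋖̸y , y⋖̸x ← opposite⇒no-cover x≺y y≺x =
    toggles-commute σ (proj₂ x≺y) x⋖̸y y⋖̸x

  diagonalSweep≈rowSweep : ∀ σ → run diagonalSweep σ ≗ run rowSweep σ
  diagonalSweep≈rowSweep = run-reorder proj₂ proj₂ opposite⇒commute diagonalSweep-sorted rowSweep-sorted
    (λ {x} _ → ∈-rowSweep x) (λ {x} _ → ∈-diagonalSweep x)

-- The identity holds for every σ.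
proposition2p29 : (P : FinPoset) (n q ℓ : ℕ) → IsGraded P n → 1 ≤ q → 1 ≤ ℓ → n + 2 ≤ q →
    (σ : Elt P (chainLen n q) → ℕ) → InA P (chainLen n q) ℓ σ →
    (x : Elt P (chainLen n q)) → TogPro P n q ℓ σ x ≡ RowComposite P n q ℓ σ x
proposition2p29 P n q ℓ graded _ _ n+2≤q σ _ x = begin
  TogPro P n q ℓ σ x          ≡⟨ cong-app (TogPro-run σ) x ⟩
  run diagonalSweep σ x       ≡⟨ diagonalSweep≈rowSweep σ x ⟩
  run rowSweep σ x            ≡⟨ cong-app (RowComposite-run σ) x ⟨
  RowComposite P n q ℓ σ x    ∎
  where
  open Sweeps P n q ℓ graded n+2≤q
  open ≡-Reasoning
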